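{- Let $n\ge 3$ and $d\ge 1$. Let $f\in\mathbb{Q}\langle x,y\rangle$ be an element of the double shuffle space $\mathfrak{ds}$ which is homogeneous of degree $n$ and such that every monomial occurring in $f$ contains at least $d$ letters $y$. Let $\bar f$ be the sum of the terms of $f$ whose monomials contain exactly $d$ letters $y$. Then $\bar f\in\mathfrak{ls}_n^d$. (In other words, $\mathfrak{ds}_n^d/\mathfrak{ds}_n^{d+1}\subset\mathfrak{ls}_n^d$ via $f\mapsto\bar f$.)
   Context: $\mathbb{Q}\langle x,y\rangle$ is the ring of non-commutative polynomials, $(f|w)$ denotes the coefficient of the word $w$ in $f$. For a polynomial $g$, $\pi_y(g)$ is the sum of the terms of $g$ whose words end in $y$; such words are rewritten in the variables $y_i=x^{i-1}y$ ($i\ge1$). The shuffle $sh(u,v)$ of two words is defined by $sh(u,1)=sh(1,u)=u$, $sh(Xu,Yv)=X\,sh(u,Yv)+Y\,sh(Xu,v)$ for letters $X,Y$ (a formal sum of words). The stuffle of words in the letters $y_i$ is defined by $st(u,1)=st(1,u)=u$ and $st(y_au,y_bv)=y_a\,st(u,y_bv)+y_b\,st(y_au,v)+y_{a+b}\,st(u,v)$. The double shuffle space $\mathfrak{ds}$ is the set of $f\in\mathbb{Q}\langle x,y\rangle$ such that (1) $\sum_{w\in sh(u,v)}(f|w)=0$ for all nonempty words $u,v$ in $x,y$ (equivalently $f$ lies in the free Lie algebra $\mathrm{Lie}[x,y]$), and (2) the polynomial $f_*=\pi_y(f)+\sum_{m\ge1}\frac{(-1)^{m-1}}{m}(f|x^{m-1}y)\,y^m$,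 written in the $y_i$, satisfies $\sum_{w\in st(u,v)}(f_*|w)=0$ for all nonempty words $u,v$ in the $y_i$. $\mathfrak{ds}_n$ is its degree-$n$ homogeneous part and $\mathfrak{ds}_n^d$ the subspace of elements all of whose monomials contain at least $d$ letters $y$. The linearized double shuffle space: for $n\ge3$, $d\ge1$, $\mathfrak{ls}_n^d$ is the space of polynomials $f\in\mathrm{Lie}[x,y]$, homogeneous of degree $n$, all of whose monomials contain exactly $d$ letters $y$, such that $\pi_y(f)$ written in the $y_i$ satisfies $\sum_{w\in sh(u,v)}(\pi_y(f)|w)=0$ for all nonempty words $u,v$ in the letters $y_i$ (shuffle in the alphabet $\{y_i\}$); by convention one sets $\mathfrak{ls}_n^1=0$ when $n$ is even (i.e. the polynomials $\mathrm{ad}(x)^{n-1}(y)$ of even degree are excluded). -}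

module Defs where

open import Data.Nat using (ℕ; zero; suc; _+_; _≤_)
open import Data.Nat.Divisibility using (_∣_)
open import Data.Nat as ℕ using ()
open import Data.Integer using (ℤ; +_; -[1+_])
open import Data.Rational using (ℚ; 0ℚ; _/_) renaming (_+_ to _+ℚ_)
open import Data.List using (List; []; _∷_; _++_; map; length; foldr; replicate; concatMap)
open import Data.Product using (_×_)
open import Relation.Binary.PropositionalEquality using (_≡_; _≢_)
open import Relation.Nullary using (¬_; yes; no)
open import Data.Empty using (⊥)
open import Data.Unit using (⊤)
open import Data.Maybe using (Maybe; just; nothing)
open import Data.Rational using (-_)

data Letter : Set where
  x y : Letter

Word : Set
Word = List Letter

-- A (non-commutative) series / polynomial is given by its coefficient
-- function w ↦ (f|w).  Finite support is ensured by homogeneity below.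
Poly : Set
Poly = Word → ℚ

sumℚ : List ℚ → ℚ
sumℚ = foldr _+ℚ_ 0ℚ

-- Shuffle of two words over any alphabet, as a formal sum (list of words).
sh : {A : Set} → List A → List A → List (List A)
sh [] v = v ∷ []
sh (a ∷ u) [] = (a ∷ u) ∷ []
sh (a ∷ u) (b ∷ v) = map (a ∷_) (sh u (b ∷ v)) ++ map (b ∷_) (sh (a ∷ u) v)

-- Letters y_i (i ≥ 1) are encoded by k : ℕ with i = k + 1, i.e. y_{k+1} = x^k y.
YWord : Set
YWord = List ℕ

-- Stuffle: y_a u * y_b v ; y_{a+b} corresponds to index (ka+1)+(kb+1)-1 = ka+kb+1.
st : YWord → YWord → List YWord
st [] v = v ∷ []
st (a ∷ u) [] = (a ∷ u) ∷ []
st (a ∷ u) (b ∷ v) =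
  map (a ∷_) (st u (b ∷ v)) ++ map (b ∷_) (st (a ∷ u) v) ++ map (suc (a + b) ∷_) (st u v)

toXY : YWord → Word
toXY = concatMap (λ k → replicate k x ++ (y ∷ []))

-- π_y(f) written in the letters y_i (the empty word does not end in y).
πy : Poly → YWord → ℚ
πy f [] = 0ℚ
πy f (k ∷ w) = f (toXY (k ∷ w))

ycount : Word → ℕ
ycount [] = 0
ycount (x ∷ w) = ycount w
ycount (y ∷ w) = suc (ycount w)

NonEmpty : {A : Set} → List A → Set
NonEmpty [] = ⊥
NonEmpty (_ ∷ _) = ⊤

-- (-1)^(m-1)/m for m = suc j
corrCoeff : ℕ → ℚ
corrCoeff j with j ℕ.% 2
... | zero = + 1 / suc j
... | suc _ = - (+ 1 / suc j)

-- if w = y_1^m with m ≥ 1, return just (m-1)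
y1power : YWord → Maybe ℕ
y1power [] = nothing
y1power (zero ∷ []) = just 0
y1power (zero ∷ w@(_ ∷ _)) = Data.Maybe.map suc (y1power w)
y1power (suc _ ∷ _) = nothing

-- f_* = π_y(f) + Σ_{m≥1} (-1)^(m-1)/m (f|x^(m-1) y) y^m, written in the y_i
fstar : Poly → YWord → ℚ
fstar f w with y1power w
... | nothing = πy f w
... | just j  = πy f w +ℚ corrCoeff j Data.Rational.* f (replicate j x ++ (y ∷ []))

-- (1) shuffle relations in x,y  (equivalently f ∈ Lie[x,y])
ShuffleXY : Poly → Set
ShuffleXY f = ∀ (u v : Word) → NonEmpty u → NonEmpty v → sumℚ (map f (sh u v)) ≡ 0ℚ

StuffleStar : Poly → Set
StuffleStar f = ∀ (u v : YWord) → NonEmpty u → NonEmpty v → sumℚ (map (fstar f) (st u v)) ≡ 0ℚ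

InDS : Poly → Set
InDS f = ShuffleXY f × StuffleStar f

Homogeneous : ℕ → Poly → Set
Homogeneous n f = ∀ w → length w ≢ n → f w ≡ 0ℚ

DepthAtLeast : ℕ → Poly → Set
DepthAtLeast d f = ∀ w → f w ≢ 0ℚ → d ≤ ycount w

DepthExactly : ℕ → Poly → Set
DepthExactly d f = ∀ w → f w ≢ 0ℚ → ycount w ≡ d

InDSnd : ℕ → ℕ → Poly → Set
InDSnd n d f = InDS f × Homogeneous n f × DepthAtLeast d f

depthPart : ℕ → Poly → Poly
depthPart d f w with ycount w ℕ.≟ d
... | yes _ = f w
... | no _  = 0ℚ

ShuffleY : Poly → Set
ShuffleY f = ∀ (u v : YWord) → NonEmpty u → NonEmpty v → sumℚ (map (πy f) (sh u v)) ≡ 0ℚ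

-- f ∈ ls_n^d  (with the convention ls_n^1 = 0 for n even)
InLS : ℕ → ℕ → Poly → Set
InLS n d f = ShuffleXY f × Homogeneous n f × DepthExactly d f × ShuffleY f
           × (d ≡ 1 → 2 ∣ n → ∀ w → f w ≡ 0ℚ)

module Submission where

-- The two shuffle conditions
-- are sums of coefficients over the shuffles of u and v, and all these words
-- have the same weight (depth for the x,y shuffle, number of letters y_i for the
-- y_i shuffle); hence they can be checked one weight at a time
-- (`eval-sh-local`).  In weight d the x,y relations are those of f itself; the
-- y_i relations come from the stuffle relations of f_*, since a stuffle is the
-- shuffle plus strictly shorter words (`eval-st≡eval-sh`), and on words of
-- depth < d both f and the correction terms of f_* vanish.
-- The last condition (ls_n^1 = 0 for even n) is the classical vanishing of the
-- depth-one part in even weight (module `EvenWeightDepthOne`): the depth-two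
-- shuffle relations kill f(y x^{n-2} y); the depth-two stuffle relations then
-- give (n+1)·f(x^{n-1} y) = 0; shuffling with x finally propagates the
-- vanishing of f(x^{n-1} y) to every word of depth one.

open import Defs
open import Data.Nat using (ℕ; _≤_)
open import Data.Nat as ℕ using (zero; suc; _<_; s≤s)
import Data.Nat.Properties as ℕP
open import Data.Nat.Divisibility using (_∣_; divides; ∣m+n∣m⇒∣n)
open import Data.Rational using (ℚ; 0ℚ; 1ℚ; _+_; _*_; -_; _-_) renaming (_<_ to _<ℚ_)
import Data.Rational.Properties as ℚP
open import Data.Rational.Solver using (module +-*-Solver)
open import Algebra.Properties.CommutativeMonoid.Mult ℚP.+-0-commutativeMonoid
  using (×-distrib-+) renaming (_×_ to _·_)
open import Algebra.Properties.Group ℚP.+-0-group using (⁻¹-involutive)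
open import Algebra.Properties.CommutativeSemigroup ℕP.+-commutativeSemigroup
  using (x∙yz≈y∙xz)
open import Data.List using (List; []; _∷_; _++_; map; length; replicate)
open import Data.Nat.ListAction using (sum)
import Data.List.Properties as LP
open import Data.Product using (Σ-syntax; _×_; _,_)
open import Data.Sum using (_⊎_; inj₁; inj₂)
open import Data.Empty using (⊥-elim)
open import Data.Unit using (tt)
open import Data.Maybe using (just; nothing)
open import Function using (_∘_; const)
open import Relation.Binary.PropositionalEquality
open import Relation.Nullary using (yes; no; ¬_)
open import Relation.Binary.Definitions using (tri<; tri≈; tri>)

open +-*-Solver
open ≡-Reasoning

eval : {A : Set} → (List A → ℚ) → List (List A) → ℚ
eval g L = sumℚ (map g L)

sumℚ-++ : ∀ (qs rs : List ℚ) → sumℚ (qs ++ rs) ≡ sumℚ qs + sumℚ rs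
sumℚ-++ [] rs = sym (ℚP.+-identityˡ _)
sumℚ-++ (q ∷ qs) rs = trans (cong (q +_) (sumℚ-++ qs rs)) (sym (ℚP.+-assoc q _ _))

eval-++ : ∀ {A : Set} (g : List A → ℚ) L K → eval g (L ++ K) ≡ eval g L + eval g K
eval-++ g L K = trans (cong sumℚ (LP.map-++ g L K)) (sumℚ-++ (map g L) (map g K))

eval-prefix : ∀ {A : Set} (g : List A → ℚ) a L → eval g (map (a ∷_) L) ≡ eval (g ∘ (a ∷_)) L
eval-prefix g a L = cong sumℚ (sym (LP.map-∘ L))

eval-zero : ∀ {A : Set} (L : List (List A)) → eval (const 0ℚ) L ≡ 0ℚ
eval-zero [] = refl
eval-zero (w ∷ L) = trans (cong (0ℚ +_) (eval-zero L)) (ℚP.+-identityʳ 0ℚ)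

eval-sh-∷ : ∀ {A : Set} (g : List A → ℚ) a b u v →
  eval g (sh (a ∷ u) (b ∷ v)) ≡ eval (g ∘ (a ∷_)) (sh u (b ∷ v)) + eval (g ∘ (b ∷_)) (sh (a ∷ u) v)
eval-sh-∷ g a b u v =
  trans (eval-++ g (map (a ∷_) (sh u (b ∷ v))) _)
        (cong₂ _+_ (eval-prefix g a (sh u (b ∷ v))) (eval-prefix g b (sh (a ∷ u) v)))

eval-st-∷ : ∀ (g : YWord → ℚ) a b u v →
  eval g (st (a ∷ u) (b ∷ v)) ≡
    eval (g ∘ (a ∷_)) (st u (b ∷ v))
      + (eval (g ∘ (b ∷_)) (st (a ∷ u) v) + eval (g ∘ (suc (a ℕ.+ b) ∷_)) (st u v))
eval-st-∷ g a b u v =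
  trans (eval-++ g (map (a ∷_) (st u (b ∷ v))) _)
   (cong₂ _+_ (eval-prefix g a (st u (b ∷ v)))
     (trans (eval-++ g (map (b ∷_) (st (a ∷ u) v)) _)
       (cong₂ _+_ (eval-prefix g b (st (a ∷ u) v)) (eval-prefix g (suc (a ℕ.+ b)) (st u v)))))

-- Weight of a word for a weighting μ of the letters: the depth for μ(x) = 0,
-- μ(y) = 1, and the length for μ = 1.
weight : {A : Set} → (A → ℕ) → List A → ℕ
weight μ w = sum (map μ w)

-- All shuffles of u and v have weight weight u + weight v, so a shuffle sum
-- only depends on g at words of that weight.
eval-sh-local : ∀ {A : Set} (μ : A → ℕ) (u v : List A) (g h : List A → ℚ) →
  (∀ w → weight μ w ≡ weight μ u ℕ.+ weight μ v → g w ≡ h w) →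
  eval g (sh u v) ≡ eval h (sh u v)
eval-sh-local μ [] v g h agree = cong (_+ 0ℚ) (agree v refl)
eval-sh-local μ (a ∷ u) [] g h agree = cong (_+ 0ℚ) (agree (a ∷ u) (sym (ℕP.+-identityʳ _)))
eval-sh-local μ (a ∷ u) (b ∷ v) g h agree = begin
  eval g (sh (a ∷ u) (b ∷ v))
    ≡⟨ eval-sh-∷ g a b u v ⟩
  eval (g ∘ (a ∷_)) (sh u (b ∷ v)) + eval (g ∘ (b ∷_)) (sh (a ∷ u) v)
    ≡⟨ cong₂ _+_ (eval-sh-local μ u (b ∷ v) _ _ agree-a) (eval-sh-local μ (a ∷ u) v _ _ agree-b) ⟩
  eval (h ∘ (a ∷_)) (sh u (b ∷ v)) + eval (h ∘ (b ∷_)) (sh (a ∷ u) v)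
    ≡⟨ eval-sh-∷ h a b u v ⟨
  eval h (sh (a ∷ u) (b ∷ v)) ∎
  where
  agree-a : ∀ w → weight μ w ≡ weight μ u ℕ.+ weight μ (b ∷ v) → g (a ∷ w) ≡ h (a ∷ w)
  agree-a w p = agree (a ∷ w) (trans (cong (μ a ℕ.+_) p) (sym (ℕP.+-assoc (μ a) _ _)))
  agree-b : ∀ w → weight μ w ≡ weight μ (a ∷ u) ℕ.+ weight μ v → g (b ∷ w) ≡ h (b ∷ w)
  agree-b w p = agree (b ∷ w) (trans (cong (μ b ℕ.+_) p) (x∙yz≈y∙xz (μ b) (weight μ (a ∷ u)) (weight μ v)))

-- Stuffles of u and v have at most |u| + |v| letters.
eval-st-short : ∀ (u v : YWord) (g : YWord → ℚ) →
  (∀ w → length w ≤ length u ℕ.+ length v → g w ≡ 0ℚ) → eval g (st u v) ≡ 0ℚ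
eval-st-short [] v g vanish = trans (cong (_+ 0ℚ) (vanish v ℕP.≤-refl)) (ℚP.+-identityʳ 0ℚ)
eval-st-short (a ∷ u) [] g vanish =
  trans (cong (_+ 0ℚ) (vanish (a ∷ u) (ℕP.≤-reflexive (sym (ℕP.+-identityʳ _))))) (ℚP.+-identityʳ 0ℚ)
eval-st-short (a ∷ u) (b ∷ v) g vanish = begin
  eval g (st (a ∷ u) (b ∷ v))
    ≡⟨ eval-st-∷ g a b u v ⟩
  eval (g ∘ (a ∷_)) (st u (b ∷ v))
    + (eval (g ∘ (b ∷_)) (st (a ∷ u) v) + eval (g ∘ (suc (a ℕ.+ b) ∷_)) (st u v))
    ≡⟨ cong₂ _+_ (eval-st-short u (b ∷ v) _ (λ w p → vanish (a ∷ w) (s≤s p)))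
                 (cong₂ _+_ (eval-st-short (a ∷ u) v _ (λ w p → vanish (b ∷ w) (shorter-b p)))
                            (eval-st-short u v _ (λ w p → vanish (_ ∷ w) (shorter-ab p)))) ⟩
  0ℚ + (0ℚ + 0ℚ) ∎
  where
  shorter-b : ∀ {m} → m ≤ length (a ∷ u) ℕ.+ length v → suc m ≤ length (a ∷ u) ℕ.+ length (b ∷ v)
  shorter-b p = s≤s (ℕP.≤-trans p (ℕP.≤-reflexive (sym (ℕP.+-suc (length u) (length v)))))
  shorter-ab : ∀ {m} → m ≤ length u ℕ.+ length v → suc m ≤ length (a ∷ u) ℕ.+ length (b ∷ v)
  shorter-ab p = s≤s (ℕP.≤-trans p (ℕP.+-monoʳ-≤ (length u) (ℕP.n≤1+n (length v))))

-- The stuffle is the shuffle plus the contracted terms y_{a+b}…, which are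
-- strictly shorter than |u| + |v|; so if g vanishes on shorter words, the
-- stuffle and shuffle sums agree.
eval-st≡eval-sh : ∀ (u v : YWord) (g : YWord → ℚ) →
  (∀ w → length w < length u ℕ.+ length v → g w ≡ 0ℚ) → eval g (st u v) ≡ eval g (sh u v)
eval-st≡eval-sh [] v g vanish = refl
eval-st≡eval-sh (a ∷ u) [] g vanish = refl
eval-st≡eval-sh (a ∷ u) (b ∷ v) g vanish = begin
  eval g (st (a ∷ u) (b ∷ v))
    ≡⟨ eval-st-∷ g a b u v ⟩
  eval (g ∘ (a ∷_)) (st u (b ∷ v))
    + (eval (g ∘ (b ∷_)) (st (a ∷ u) v) + eval (g ∘ (suc (a ℕ.+ b) ∷_)) (st u v))
    ≡⟨ cong₂ _+_ (eval-st≡eval-sh u (b ∷ v) _ (λ w p → vanish (a ∷ w) (s≤s p)))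
                 (cong₂ _+_ (eval-st≡eval-sh (a ∷ u) v _ (λ w p → vanish (b ∷ w) (longer p)))
                            (eval-st-short u v _ (λ w p → vanish (_ ∷ w) (longer (s≤s p))))) ⟩
  eval (g ∘ (a ∷_)) (sh u (b ∷ v)) + (eval (g ∘ (b ∷_)) (sh (a ∷ u) v) + 0ℚ)
    ≡⟨ cong (eval (g ∘ (a ∷_)) (sh u (b ∷ v)) +_) (ℚP.+-identityʳ _) ⟩
  eval (g ∘ (a ∷_)) (sh u (b ∷ v)) + eval (g ∘ (b ∷_)) (sh (a ∷ u) v)
    ≡⟨ eval-sh-∷ g a b u v ⟨
  eval g (sh (a ∷ u) (b ∷ v)) ∎
  where
  longer : ∀ {m} → m < length (a ∷ u) ℕ.+ length v → suc m < length (a ∷ u) ℕ.+ length (b ∷ v)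
  longer p = s≤s (ℕP.≤-trans p (ℕP.≤-reflexive (sym (ℕP.+-suc (length u) (length v)))))

depthPart-cases : ∀ d f w → (ycount w ≡ d × depthPart d f w ≡ f w) ⊎ (depthPart d f w ≡ 0ℚ)
depthPart-cases d f w with ycount w ℕ.≟ d
... | yes p = inj₁ (p , refl)
... | no _ = inj₂ refl

depthPart-in : ∀ d f w → ycount w ≡ d → depthPart d f w ≡ f w
depthPart-in d f w p with ycount w ℕ.≟ d
... | yes _ = refl
... | no q = ⊥-elim (q p)

depthPart-out : ∀ d f w → ¬ (ycount w ≡ d) → depthPart d f w ≡ 0ℚ
depthPart-out d f w p with ycount w ℕ.≟ d
... | yes q = ⊥-elim (p q)
... | no _ = refl

μ-depth : Letter → ℕ
μ-depth x = 0
μ-depth y = 1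

ycount-weight : ∀ w → ycount w ≡ weight μ-depth w
ycount-weight [] = refl
ycount-weight (x ∷ w) = ycount-weight w
ycount-weight (y ∷ w) = cong suc (ycount-weight w)

length-weight : ∀ {A : Set} (w : List A) → length w ≡ weight (const 1) w
length-weight [] = refl
length-weight (a ∷ w) = cong suc (length-weight w)

x^_ : ℕ → Word
x^ k = replicate k x

ycount-x^ : ∀ k r → ycount (x^ k ++ r) ≡ ycount r
ycount-x^ zero r = refl
ycount-x^ (suc k) r = ycount-x^ k r

ycount-toXY : ∀ w → ycount (toXY w) ≡ length w
ycount-toXY [] = refl
ycount-toXY (k ∷ w) = begin
  ycount ((x^ k ++ y ∷ []) ++ toXY w) ≡⟨ cong ycount (LP.++-assoc (x^ k) (y ∷ []) (toXY w)) ⟩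
  ycount (x^ k ++ y ∷ toXY w)        ≡⟨ ycount-x^ k (y ∷ toXY w) ⟩
  suc (ycount (toXY w))               ≡⟨ cong suc (ycount-toXY w) ⟩
  suc (length w)                      ∎

below-depth : ∀ d (f : Poly) → DepthAtLeast d f → ∀ w → ycount w < d → f w ≡ 0ℚ
below-depth d f deep w lt with f w ℚP.≟ 0ℚ
... | yes p = p
... | no nonzero = ⊥-elim (ℕP.<⇒≱ lt (deep w nonzero))

fstar-πy : ∀ (f : Poly) → (∀ j → f (x^ j ++ y ∷ []) ≡ 0ℚ) → ∀ w → fstar f w ≡ πy f w
fstar-πy f depth1-zero w with y1power w
... | nothing = refl
... | just j = begin
  πy f w + corrCoeff j * f (x^ j ++ y ∷ []) ≡⟨ cong (λ c → πy f w + corrCoeff j * c) (depth1-zero j) ⟩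
  πy f w + corrCoeff j * 0ℚ                 ≡⟨ cong (πy f w +_) (ℚP.*-zeroʳ (corrCoeff j)) ⟩
  πy f w + 0ℚ                               ≡⟨ ℚP.+-identityʳ _ ⟩
  πy f w                                    ∎

-- f̄ satisfies the shuffle relations in x, y: in depth d they are those of f,
-- in any other depth they read 0 = 0.
depthPart-shuffleXY : ∀ d f → ShuffleXY f → ShuffleXY (depthPart d f)
depthPart-shuffleXY d f shuffle u v nu nv with (ycount u ℕ.+ ycount v) ℕ.≟ d
... | yes total≡d =
  trans (eval-sh-local μ-depth u v (depthPart d f) f (λ w p → depthPart-in d f w (depth≡ w p)))
        (shuffle u v nu nv)
  where
  depth≡ : ∀ w → weight μ-depth w ≡ weight μ-depth u ℕ.+ weight μ-depth v → ycount w ≡ d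
  depth≡ w p = begin
    ycount w                                      ≡⟨ ycount-weight w ⟩
    weight μ-depth w                              ≡⟨ p ⟩
    weight μ-depth u ℕ.+ weight μ-depth v         ≡⟨ cong₂ ℕ._+_ (ycount-weight u) (ycount-weight v) ⟨
    ycount u ℕ.+ ycount v                         ≡⟨ total≡d ⟩
    d                                             ∎
... | no total≢d =
  trans (eval-sh-local μ-depth u v (depthPart d f) (const 0ℚ) (λ w p → depthPart-out d f w (depth≢ w p)))
        (eval-zero (sh u v))
  where
  depth≢ : ∀ w → weight μ-depth w ≡ weight μ-depth u ℕ.+ weight μ-depth v → ¬ (ycount w ≡ d)
  depth≢ w p w-depth = total≢d (begin
    ycount u ℕ.+ ycount v                         ≡⟨ cong₂ ℕ._+_ (ycount-weight u) (ycount-weight v) ⟩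
    weight μ-depth u ℕ.+ weight μ-depth v         ≡⟨ p ⟨
    weight μ-depth w                              ≡⟨ ycount-weight w ⟨
    ycount w                                      ≡⟨ w-depth ⟩
    d                                             ∎)

depthPart-homogeneous : ∀ n d f → Homogeneous n f → Homogeneous n (depthPart d f)
depthPart-homogeneous n d f homogeneous w wrong-length with depthPart-cases d f w
... | inj₁ (_ , agrees) = trans agrees (homogeneous w wrong-length)
... | inj₂ vanishes = vanishes

depthPart-depthExactly : ∀ d f → DepthExactly d (depthPart d f)
depthPart-depthExactly d f w nonzero with depthPart-cases d f w
... | inj₁ (depth , _) = depth
... | inj₂ vanishes = ⊥-elim (nonzero vanishes)

-- For |u| + |v| = d ≥ 2 they are
-- the stuffle relations of f_*: f_* agrees with π_y(f̄) in length d, and it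
-- vanishes in length < d; in any other length they read 0 = 0.
depthPart-shuffleY : ∀ d f → DepthAtLeast d f → StuffleStar f → ShuffleY (depthPart d f)
depthPart-shuffleY d f deep stuffle [] v () nv
depthPart-shuffleY d f deep stuffle (_ ∷ _) [] nu ()
depthPart-shuffleY d f deep stuffle u@(_ ∷ _) v@(_ ∷ _) nu nv with (length u ℕ.+ length v) ℕ.≟ d
... | yes total≡d = begin
  eval (πy (depthPart d f)) (sh u v)  ≡⟨ eval-sh-local (const 1) u v _ (fstar f) agree ⟩
  eval (fstar f) (sh u v)             ≡⟨ eval-st≡eval-sh u v (fstar f) shorter ⟨
  eval (fstar f) (st u v)             ≡⟨ stuffle u v nu nv ⟩
  0ℚ                                  ∎
  where
  depth1-zero : ∀ j → f (x^ j ++ y ∷ []) ≡ 0ℚ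
  depth1-zero j = below-depth d f deep _
    (subst (_< d) (sym (ycount-x^ j (y ∷ []))) (subst (1 <_) total≡d (ℕP.+-mono-≤ (s≤s ℕ.z≤n) (s≤s ℕ.z≤n))))
  length≡d : ∀ w → weight (const 1) w ≡ weight (const 1) u ℕ.+ weight (const 1) v → length w ≡ d
  length≡d w p =
    trans (length-weight w) (trans p (trans (sym (cong₂ ℕ._+_ (length-weight u) (length-weight v))) total≡d))
  agree : ∀ w → weight (const 1) w ≡ weight (const 1) u ℕ.+ weight (const 1) v →
          πy (depthPart d f) w ≡ fstar f w
  agree [] p = sym (fstar-πy f depth1-zero [])
  agree (k ∷ w) p = trans (depthPart-in d f (toXY (k ∷ w)) (trans (ycount-toXY (k ∷ w)) (length≡d (k ∷ w) p)))
                          (sym (fstar-πy f depth1-zero (k ∷ w)))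
  shorter : ∀ w → length w < length u ℕ.+ length v → fstar f w ≡ 0ℚ
  shorter [] p = fstar-πy f depth1-zero []
  shorter (k ∷ w) p = trans (fstar-πy f depth1-zero (k ∷ w))
    (below-depth d f deep _ (subst (_< d) (sym (ycount-toXY (k ∷ w))) (subst (length (k ∷ w) <_) total≡d p)))
... | no total≢d = trans (eval-sh-local (const 1) u v _ (const 0ℚ) off-weight) (eval-zero (sh u v))
  where
  off-weight : ∀ w → weight (const 1) w ≡ weight (const 1) u ℕ.+ weight (const 1) v →
               πy (depthPart d f) w ≡ 0ℚ
  off-weight [] p = refl
  off-weight (k ∷ w) p = depthPart-out d f (toXY (k ∷ w)) λ w-depth → total≢d (begin
    length u ℕ.+ length v                                ≡⟨ cong₂ ℕ._+_ (length-weight u) (length-weight v) ⟩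
    weight (const 1) u ℕ.+ weight (const 1) v            ≡⟨ p ⟨
    weight (const 1) (k ∷ w)                             ≡⟨ length-weight (k ∷ w) ⟨
    length (k ∷ w)                                       ≡⟨ ycount-toXY (k ∷ w) ⟨
    ycount (toXY (k ∷ w))                                ≡⟨ w-depth ⟩
    d                                                    ∎)

-- ℚ is torsion-free: a nonzero multiple (k+1)·c vanishes only for c = 0.
-- The shuffle and stuffle relations below produce exactly such multiples.
·-zeroʳ : ∀ k → k · 0ℚ ≡ 0ℚ
·-zeroʳ zero = refl
·-zeroʳ (suc k) = trans (cong (0ℚ +_) (·-zeroʳ k)) (ℚP.+-identityʳ 0ℚ)

·-negative : ∀ k c → c <ℚ 0ℚ → suc k · c <ℚ 0ℚ
·-negative zero c c<0 = subst (_<ℚ 0ℚ) (sym (ℚP.+-identityʳ c)) c<0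
·-negative (suc k) c c<0 =
  subst (suc (suc k) · c <ℚ_) (ℚP.+-identityʳ 0ℚ) (ℚP.+-mono-< c<0 (·-negative k c c<0))

·-positive : ∀ k c → 0ℚ <ℚ c → 0ℚ <ℚ suc k · c
·-positive zero c 0<c = subst (0ℚ <ℚ_) (sym (ℚP.+-identityʳ c)) 0<c
·-positive (suc k) c 0<c =
  subst (_<ℚ suc (suc k) · c) (ℚP.+-identityʳ 0ℚ) (ℚP.+-mono-< 0<c (·-positive k c 0<c))

·-torsionFree : ∀ k c → suc k · c ≡ 0ℚ → c ≡ 0ℚ
·-torsionFree k c kc≡0 with ℚP.<-cmp c 0ℚ
... | tri< c<0 _ _ = ⊥-elim (ℚP.<-irrefl kc≡0 (·-negative k c c<0))
... | tri≈ _ c≡0 _ = c≡0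
... | tri> _ _ 0<c = ⊥-elim (ℚP.<-irrefl (sym kc≡0) (·-positive k c 0<c))

-- Sum of Q i j over the antidiagonal i + j = m.
antidiagonal : (ℕ → ℕ → ℚ) → ℕ → ℚ
antidiagonal Q zero = Q 0 0
antidiagonal Q (suc m) = Q 0 (suc m) + antidiagonal (λ i j → Q (suc i) j) m

antidiagonal-last : ∀ Q m → antidiagonal Q (suc m) ≡ antidiagonal (λ i j → Q i (suc j)) m + Q (suc m) 0
antidiagonal-last Q zero = refl
antidiagonal-last Q (suc m) =
  trans (cong (Q 0 (suc (suc m)) +_) (antidiagonal-last (λ i j → Q (suc i) j) m))
        (sym (ℚP.+-assoc (Q 0 (suc (suc m))) _ _))

antidiagonal-pairing : ∀ m (Q R : ℕ → ℕ → ℚ) C → (∀ i j → i ℕ.+ j ≡ m → Q i j + R j i ≡ C) →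
  antidiagonal Q m + antidiagonal R m ≡ suc m · C
antidiagonal-pairing zero Q R C sym-sum = trans (sym-sum 0 0 refl) (sym (ℚP.+-identityʳ C))
antidiagonal-pairing (suc m) Q R C sym-sum = begin
  antidiagonal Q (suc m) + antidiagonal R (suc m)
    ≡⟨ cong (antidiagonal Q (suc m) +_) (antidiagonal-last R m) ⟩
  (Q 0 (suc m) + Q′) + (R′ + R (suc m) 0)
    ≡⟨ solve 4 (λ a b c d → (a :+ b) :+ (c :+ d) := (a :+ d) :+ (b :+ c)) refl (Q 0 (suc m)) Q′ R′ (R (suc m) 0) ⟩
  (Q 0 (suc m) + R (suc m) 0) + (Q′ + R′)
    ≡⟨ cong₂ _+_ (sym-sum 0 (suc m) refl)
                 (antidiagonal-pairing m _ _ C (λ i j p → sym-sum (suc i) j (cong suc p))) ⟩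
  C + suc m · C ∎
  where
  Q′ = antidiagonal (λ i j → Q (suc i) j) m
  R′ = antidiagonal (λ i j → R i (suc j)) m

-- Depth-one and depth-two words: x^a y x^b, and x^i y x^j y ↔ y_{i+1} y_{j+1}.
word1 : ℕ → ℕ → Word
word1 a b = x^ a ++ y ∷ x^ b

word2 : ℕ → ℕ → Word
word2 i j = x^ i ++ y ∷ x^ j ++ y ∷ []

shuffle2 : (Word → ℚ) → ℕ → ℕ → ℚ
shuffle2 g a b = eval g (sh (x^ a ++ y ∷ []) (x^ b ++ y ∷ []))

shuffleX : (Word → ℚ) → Word → ℚ
shuffleX g u = eval g (sh u (x ∷ []))

shuffle2-x-x : ∀ g a b → shuffle2 g (suc a) (suc b) ≡ shuffle2 (g ∘ (x ∷_)) a (suc b) + shuffle2 (g ∘ (x ∷_)) (suc a) b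
shuffle2-x-x g a b = eval-sh-∷ g x x (x^ a ++ y ∷ []) (x^ b ++ y ∷ [])

shuffle2-y-x : ∀ g b → shuffle2 g 0 (suc b) ≡ g (word2 0 (suc b)) + shuffle2 (g ∘ (x ∷_)) 0 b
shuffle2-y-x g b =
  trans (eval-sh-∷ g y x [] (x^ b ++ y ∷ [])) (cong (_+ shuffle2 (g ∘ (x ∷_)) 0 b) (ℚP.+-identityʳ (g (word2 0 (suc b)))))

shuffle2-x-y : ∀ g a → shuffle2 g (suc a) 0 ≡ shuffle2 (g ∘ (x ∷_)) a 0 + g (word2 0 (suc a))
shuffle2-x-y g a =
  trans (eval-sh-∷ g x y (x^ a ++ y ∷ []) []) (cong (shuffle2 (g ∘ (x ∷_)) a 0 +_) (ℚP.+-identityʳ (g (word2 0 (suc a)))))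

shuffle2-y : ∀ g m → shuffle2 g 0 m ≡ antidiagonal (λ i j → g (word2 i j)) m + g (word2 m 0)
shuffle2-y g zero = cong (g (word2 0 0) +_) (ℚP.+-identityʳ (g (word2 0 0)))
shuffle2-y g (suc m) =
  trans (shuffle2-y-x g m)
   (trans (cong (g (word2 0 (suc m)) +_) (shuffle2-y (g ∘ (x ∷_)) m))
          (sym (ℚP.+-assoc (g (word2 0 (suc m))) _ _)))

sign : ℕ → ℚ
sign zero = 1ℚ
sign (suc a) = - sign a

-- The alternating sum Σ_{i ≤ a} (-1)^{a-i} (g | x^i y ⧢ x^{a+b-i} y).  In it the
-- words beginning with x telescope away, leaving only y x^{a+b} y.
altShuffle2 : (Word → ℚ) → ℕ → ℕ → ℚ
altShuffle2 g zero b = shuffle2 g 0 b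
altShuffle2 g (suc a) b = shuffle2 g (suc a) b - altShuffle2 g a (suc b)

altShuffle2-telescope : ∀ a b g →
  altShuffle2 g a (suc b) ≡ sign a * g (word2 0 (suc (a ℕ.+ b))) + shuffle2 (g ∘ (x ∷_)) a b
altShuffle2-telescope zero b g =
  trans (shuffle2-y-x g b) (cong (_+ shuffle2 (g ∘ (x ∷_)) 0 b) (sym (ℚP.*-identityˡ (g (word2 0 (suc b))))))
altShuffle2-telescope (suc a) b g = begin
  shuffle2 g (suc a) (suc b) - altShuffle2 g a (suc (suc b))
    ≡⟨ cong₂ _-_ (shuffle2-x-x g a b) (altShuffle2-telescope a (suc b) g) ⟩
  (P + P′) - (sign a * g (word2 0 (suc (a ℕ.+ suc b))) + P)
    ≡⟨ cong (λ m → (P + P′) - (sign a * g (word2 0 (suc m)) + P)) (ℕP.+-suc a b) ⟩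
  (P + P′) - (sign a * G + P)
    ≡⟨ solve 4 (λ p p′ s G → (p :+ p′) :- (s :* G :+ p) := (:- s) :* G :+ p′) refl P P′ (sign a) G ⟩
  - sign a * G + P′ ∎
  where
  P = shuffle2 (g ∘ (x ∷_)) a (suc b)
  P′ = shuffle2 (g ∘ (x ∷_)) (suc a) b
  G = g (word2 0 (suc (suc (a ℕ.+ b))))

altShuffle2-end : ∀ a g → altShuffle2 g (suc a) 0 ≡ g (word2 0 (suc a)) - sign a * g (word2 0 (suc a))
altShuffle2-end a g = begin
  shuffle2 g (suc a) 0 - altShuffle2 g a 1
    ≡⟨ cong₂ _-_ (shuffle2-x-y g a) (altShuffle2-telescope a 0 g) ⟩
  (P + G) - (sign a * g (word2 0 (suc (a ℕ.+ 0))) + P)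
    ≡⟨ cong (λ m → (P + G) - (sign a * g (word2 0 (suc m)) + P)) (ℕP.+-identityʳ a) ⟩
  (P + G) - (sign a * G + P)
    ≡⟨ solve 3 (λ p G s → (p :+ G) :- (s :* G :+ p) := G :- s :* G) refl P G (sign a) ⟩
  G - sign a * G ∎
  where
  P = shuffle2 (g ∘ (x ∷_)) a 0
  G = g (word2 0 (suc a))

sign-even-weight : ∀ a → 2 ∣ 3 ℕ.+ a → sign a ≡ - 1ℚ
sign-even-weight zero (divides zero ())
sign-even-weight zero (divides (suc zero) ())
sign-even-weight zero (divides (suc (suc q)) ())
sign-even-weight (suc zero) _ = refl
sign-even-weight (suc (suc a)) even =
  trans (⁻¹-involutive (sign a)) (sign-even-weight a (∣m+n∣m⇒∣n even (divides 1 refl)))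

shuffleX-x^ : ∀ b g → shuffleX g (x^ b) ≡ suc b · g (x^ (suc b))
shuffleX-x^ zero g = refl
shuffleX-x^ (suc b) g = begin
  shuffleX g (x^ (suc b))
    ≡⟨ eval-sh-∷ g x x (x^ b) [] ⟩
  shuffleX (g ∘ (x ∷_)) (x^ b) + (G + 0ℚ)
    ≡⟨ cong₂ _+_ (shuffleX-x^ b (g ∘ (x ∷_))) (ℚP.+-identityʳ G) ⟩
  suc b · G + G
    ≡⟨ ℚP.+-comm (suc b · G) G ⟩
  suc (suc b) · G ∎
  where G = g (x^ (suc (suc b)))

shuffleX-word1 : ∀ a b g →
  shuffleX g (word1 a b) ≡ suc b · g (word1 a (suc b)) + suc a · g (word1 (suc a) b)
shuffleX-word1 zero b g =
  trans (eval-sh-∷ g y x (x^ b) [])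
        (cong (_+ (g (word1 1 b) + 0ℚ)) (shuffleX-x^ b (g ∘ (y ∷_))))
shuffleX-word1 (suc a) b g = begin
  shuffleX g (word1 (suc a) b)
    ≡⟨ eval-sh-∷ g x x (word1 a b) [] ⟩
  shuffleX (g ∘ (x ∷_)) (word1 a b) + (G + 0ℚ)
    ≡⟨ cong₂ _+_ (shuffleX-word1 a b (g ∘ (x ∷_))) (ℚP.+-identityʳ G) ⟩
  (suc b · g (word1 (suc a) (suc b)) + suc a · G) + G
    ≡⟨ solve 3 (λ p q G → (p :+ q) :+ G := p :+ (G :+ q)) refl (suc b · g (word1 (suc a) (suc b))) (suc a · G) G ⟩
  suc b · g (word1 (suc a) (suc b)) + suc (suc a) · G ∎
  where G = g (word1 (suc (suc a)) b)

nonEmpty-word : ∀ a r → NonEmpty (x^ a ++ y ∷ r)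
nonEmpty-word zero r = tt
nonEmpty-word (suc a) r = tt

depth-one-word : ∀ w → ycount w ≡ 1 → Σ[ a ∈ ℕ ] Σ[ b ∈ ℕ ] w ≡ word1 a b
depth-one-word [] ()
depth-one-word (x ∷ w) depth with depth-one-word w depth
... | a , b , w≡ = suc a , b , cong (x ∷_) w≡
depth-one-word (y ∷ w) depth = 0 , length w , cong (y ∷_) (all-x w (ℕP.suc-injective depth))
  where
  all-x : ∀ w → ycount w ≡ 0 → w ≡ x^ (length w)
  all-x [] _ = refl
  all-x (x ∷ w) p = cong (x ∷_) (all-x w p)
  all-x (y ∷ w) ()

length-word1 : ∀ a b → length (word1 a b) ≡ a ℕ.+ suc b
length-word1 a b =
  trans (LP.length-++ (x^ a)) (cong₂ ℕ._+_ (LP.length-replicate a) (cong suc (LP.length-replicate b)))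

toXY-one : ∀ m → toXY (m ∷ []) ≡ x^ m ++ y ∷ []
toXY-one m = LP.++-identityʳ (x^ m ++ y ∷ [])

toXY-two : ∀ i j → toXY (i ∷ j ∷ []) ≡ word2 i j
toXY-two i j = trans (cong ((x^ i ++ y ∷ []) ++_) (LP.++-identityʳ (x^ j ++ y ∷ [])))
                     (LP.++-assoc (x^ i) (y ∷ []) (x^ j ++ y ∷ []))

-- y_{i+1} y_{j+1} with i + j ≥ 1 is not a power of y_1, so f_* = π_y(f) there.
not-y1-power : ∀ i j m → i ℕ.+ j ≡ suc m → y1power (i ∷ j ∷ []) ≡ nothing
not-y1-power (suc i) j m _ = refl
not-y1-power zero .(suc m) m refl = refl

fstar-two : ∀ f i j m → i ℕ.+ j ≡ suc m → fstar f (i ∷ j ∷ []) ≡ f (word2 i j)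
fstar-two f i j m i+j≡ with y1power (i ∷ j ∷ []) | not-y1-power i j m i+j≡
... | nothing | _ = cong f (toXY-two i j)
... | just _ | ()

-- The classical vanishing of the depth-one part of a double shuffle element of
-- even weight n = k + 3, with c = f(x^{n-1} y) and Q i j = f(x^i y x^j y).
module EvenWeightDepthOne (k : ℕ) (f : Poly) (shuffle : ShuffleXY f) (stuffle : StuffleStar f)
                          (homogeneous : Homogeneous (3 ℕ.+ k) f) (even : 2 ∣ 3 ℕ.+ k) where

  c : ℚ
  c = f (x^ (2 ℕ.+ k) ++ y ∷ [])

  Q : ℕ → ℕ → ℚ
  Q i j = f (word2 i j)

  -- Every alternating shuffle sum is a combination of shuffle relations of f.
  altShuffle2-vanishes : ∀ a b → altShuffle2 f a b ≡ 0ℚ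
  altShuffle2-vanishes zero b = shuffle (y ∷ []) (x^ b ++ y ∷ []) tt (nonEmpty-word b [])
  altShuffle2-vanishes (suc a) b =
    trans (cong₂ _-_ (shuffle (x^ (suc a) ++ y ∷ []) (x^ b ++ y ∷ []) tt (nonEmpty-word b []))
                     (altShuffle2-vanishes a (suc b)))
          (ℚP.+-inverseʳ 0ℚ)

  -- f(y x^{n-2} y) = 0: the telescoped alternating shuffle gives 2·f(y x^{n-2} y) = 0.
  palindrome-vanishes : Q 0 (suc k) ≡ 0ℚ
  palindrome-vanishes = ·-torsionFree 1 G (begin
    G + (G + 0ℚ)          ≡⟨ solve 1 (λ G → G :+ (G :+ con 0ℚ) := G :- (:- con 1ℚ) :* G) refl G ⟩
    G - (- 1ℚ) * G        ≡⟨ cong (λ s → G - s * G) (sign-even-weight k even) ⟨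
    G - sign k * G        ≡⟨ altShuffle2-end k f ⟨
    altShuffle2 f (suc k) 0 ≡⟨ altShuffle2-vanishes (suc k) 0 ⟩
    0ℚ                    ∎)
    where G = Q 0 (suc k)

  -- The stuffle relation y_{i+1} ∗ y_{j+1}: Q i j + Q j i + c = 0.
  stuffle-depth2 : ∀ i j → i ℕ.+ j ≡ suc k → Q i j + Q j i ≡ - c
  stuffle-depth2 i j i+j≡ = begin
    Q i j + Q j i                          ≡⟨ solve 3 (λ a b c → a :+ b := (a :+ (b :+ (c :+ con 0ℚ))) :- c) refl (Q i j) (Q j i) c ⟩
    (Q i j + (Q j i + (c + 0ℚ))) - c       ≡⟨ cong (_- c) relation ⟩
    0ℚ - c                                 ≡⟨ ℚP.+-identityˡ (- c) ⟩
    - c                                    ∎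
    where
    contracted : fstar f (suc (i ℕ.+ j) ∷ []) ≡ c
    contracted = trans (cong f (toXY-one (suc (i ℕ.+ j)))) (cong (λ m → f (x^ (suc m) ++ y ∷ [])) i+j≡)
    relation : Q i j + (Q j i + (c + 0ℚ)) ≡ 0ℚ
    relation = trans (sym (cong₂ _+_ (fstar-two f i j k i+j≡)
                            (cong₂ _+_ (fstar-two f j i k (trans (ℕP.+-comm j i) i+j≡)) (cong (_+ 0ℚ) contracted))))
                     (stuffle (i ∷ []) (j ∷ []) tt tt)

  -- Σ_{i+j=k+1} Q i j = c, from (y ⧢ x^{k+1} y) = 0 and Q (k+1) 0 = -c.
  antidiagonal-is-c : antidiagonal Q (suc k) ≡ c
  antidiagonal-is-c = begin
    antidiagonal Q (suc k)                         ≡⟨ solve 2 (λ s a → s := (s :+ a) :- a) refl (antidiagonal Q (suc k)) (Q (suc k) 0) ⟩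
    (antidiagonal Q (suc k) + Q (suc k) 0) - Q (suc k) 0
                                                   ≡⟨ cong₂ _-_ (trans (sym (shuffle2-y f (suc k))) (shuffle (y ∷ []) (x^ (suc k) ++ y ∷ []) tt tt)) last ⟩
    0ℚ - (- c)                                     ≡⟨ solve 1 (λ c → con 0ℚ :- (:- c) := c) refl c ⟩
    c                                              ∎
    where
    last : Q (suc k) 0 ≡ - c
    last = begin
      Q (suc k) 0                    ≡⟨ ℚP.+-identityʳ _ ⟨
      Q (suc k) 0 + 0ℚ               ≡⟨ cong (Q (suc k) 0 +_) palindrome-vanishes ⟨
      Q (suc k) 0 + Q 0 (suc k)      ≡⟨ stuffle-depth2 (suc k) 0 (ℕP.+-identityʳ (suc k)) ⟩
      - c                            ∎

  -- Pairing the antidiagonal with itself: 2c = (k+2)·(-c), i.e. (k+4)·c = 0.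
  c-vanishes : c ≡ 0ℚ
  c-vanishes = ·-torsionFree (3 ℕ.+ k) c (begin
    c + (c + N · c)                ≡⟨ ℚP.+-assoc c c (N · c) ⟨
    (c + c) + N · c                ≡⟨ cong (λ s → (s + s) + N · c) antidiagonal-is-c ⟨
    (A + A) + N · c                ≡⟨ cong (_+ N · c) (antidiagonal-pairing (suc k) Q Q (- c) stuffle-depth2) ⟩
    N · (- c) + N · c              ≡⟨ ×-distrib-+ (- c) c N ⟨
    N · (- c + c)                  ≡⟨ cong (N ·_) (ℚP.+-inverseˡ c) ⟩
    N · 0ℚ                         ≡⟨ ·-zeroʳ N ⟩
    0ℚ                             ∎)
    where
    N = 2 ℕ.+ k
    A = antidiagonal Q (suc k)

  -- f(x^a y x^b) = 0 in weight n, by induction on b: the relation (x^a y x^b ⧢ x) = 0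
  -- expresses (b+1)·f(x^a y x^{b+1}) through f(x^{a+1} y x^b).
  weight-n-depth-one : ∀ b a → a ℕ.+ b ≡ 2 ℕ.+ k → f (word1 a b) ≡ 0ℚ
  weight-n-depth-one zero a a+0≡ =
    trans (cong (λ m → f (x^ m ++ y ∷ [])) (trans (sym (ℕP.+-identityʳ a)) a+0≡)) c-vanishes
  weight-n-depth-one (suc b) a a+b≡ = ·-torsionFree b (f (word1 a (suc b))) (begin
    suc b · f (word1 a (suc b))                                     ≡⟨ ℚP.+-identityʳ _ ⟨
    suc b · f (word1 a (suc b)) + 0ℚ                                ≡⟨ cong (suc b · f (word1 a (suc b)) +_) previous ⟨
    suc b · f (word1 a (suc b)) + suc a · f (word1 (suc a) b)       ≡⟨ shuffleX-word1 a b f ⟨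
    shuffleX f (word1 a b)                                          ≡⟨ shuffle (word1 a b) (x ∷ []) (nonEmpty-word a _) tt ⟩
    0ℚ                                                              ∎)
    where
    previous : suc a · f (word1 (suc a) b) ≡ 0ℚ
    previous = trans (cong (suc a ·_) (weight-n-depth-one b (suc a) (trans (sym (ℕP.+-suc a b)) a+b≡)))
                     (·-zeroʳ (suc a))

  depth-one-vanishes : ∀ w → ycount w ≡ 1 → f w ≡ 0ℚ
  depth-one-vanishes w depth with depth-one-word w depth
  ... | a , b , refl with (a ℕ.+ b) ℕ.≟ 2 ℕ.+ k
  ...   | yes a+b≡ = weight-n-depth-one b a a+b≡
  ...   | no a+b≢ = homogeneous (word1 a b) λ length≡ →
            a+b≢ (ℕP.suc-injective (trans (sym (ℕP.+-suc a b)) (trans (sym (length-word1 a b)) length≡)))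

proposition1p4p1 : (n d : ℕ) → 3 ≤ n → 1 ≤ d → (f : Poly) →
    InDSnd n d f → InLS n d (depthPart d f)
proposition1p4p1 (suc (suc (suc k))) d (s≤s (s≤s (s≤s _))) _ f ((shuffle , stuffle) , homogeneous , deep) =
    depthPart-shuffleXY d f shuffle
  , depthPart-homogeneous _ d f homogeneous
  , depthPart-depthExactly d f
  , depthPart-shuffleY d f deep stuffle
  , even-depth-one
  where
  even-depth-one : d ≡ 1 → 2 ∣ 3 ℕ.+ k → ∀ w → depthPart d f w ≡ 0ℚ
  even-depth-one refl even w with depthPart-cases 1 f w
  ... | inj₁ (depth , agrees) =
        trans agrees (EvenWeightDepthOne.depth-one-vanishes k f shuffle stuffle homogeneous even w depth)
  ... | inj₂ vanishes = vanishes
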